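{- If $F$ is a corank-2 flat of $\Theta_n$, then either (1) $F = (X \cup Y) - \{y_i, y_j, y_k, y_l\}$ for distinct $i,j,k,l \in [n]$, or (2) $F = (Y - \{y_i, y_j, y_k\}) \cup x_l$ for distinct $i,j,k,l \in [n]$, or (3) $F = (Y - \{y_i, y_j, y_k\}) \cup x_i$ for distinct $i,j,k \in [n]$, or (4) $F = Y - \{y_i, y_j\}$ for distinct $i,j \in [n]$.
   Context: For an integer $n \ge 2$, $\Theta_n$ is the matroid on ground set $X \sqcup Y$, where $X = \{x_1, \dots, x_n\}$ and $Y = \{y_1, \dots, y_n\}$, whose bases are: $Y$; the sets $(Y - \{y_i\}) \cup \{x_j\}$ for distinct $i,j \in [n]$; and the sets $(Y - Y') \cup X'$ where $Y' \subseteq Y$, $X' \subseteq X$ and $|Y'| = |X'| = 2$. (Then $X$ is a modular flat of $\Theta_n$ and $\Theta_n|X \cong U_{2,n}$.) -}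

module Defs where

open import Data.Nat using (ℕ; _≤_; _<_; _+_)
open import Data.Fin using (Fin)
open import Data.Fin.Subset using (Subset; ⊥; ⊤; ⁅_⁆; _∪_; _-_; ∣_∣)
  renaming (_⊆_ to _⊆ₛ_; _∈_ to _∈ₛ_)
open import Data.Sum using (_⊎_; inj₁; inj₂)
open import Data.Product using (_×_; _,_; ∃; ∃-syntax)
open import Relation.Binary.PropositionalEquality using (_≡_; _≢_)
open import Relation.Nullary using (¬_)

-- Ground set of Θ_n is X ⊔ Y; an element is  x i  (inj₁ i) or  y i  (inj₂ i).
Elt : ℕ → Set
Elt n = Fin n ⊎ Fin n

ESet : ℕ → Set
ESet n = Subset n × Subset n

_∈E_ : ∀ {n} → Elt n → ESet n → Set
inj₁ i ∈E (A , B) = i ∈ₛ A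
inj₂ i ∈E (A , B) = i ∈ₛ B

_⊆E_ : ∀ {n} → ESet n → ESet n → Set
(A , B) ⊆E (A' , B') = (A ⊆ₛ A') × (B ⊆ₛ B')

size : ∀ {n} → ESet n → ℕ
size (A , B) = ∣ A ∣ + ∣ B ∣

insert : ∀ {n} → Elt n → ESet n → ESet n
insert (inj₁ i) (A , B) = (⁅ i ⁆ ∪ A , B)
insert (inj₂ i) (A , B) = (A , ⁅ i ⁆ ∪ B)

groundE : ∀ {n} → ESet n
groundE = (⊤ , ⊤)

data IsBasisΘ (n : ℕ) : ESet n → Set where
  basisY  : IsBasisΘ n (⊥ , ⊤)
  basis1  : (i j : Fin n) → i ≢ j → IsBasisΘ n (⁅ j ⁆ , ⊤ - i)
  basis2  : (a b c d : Fin n) → a ≢ b → c ≢ d →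
            IsBasisΘ n (⁅ a ⁆ ∪ ⁅ b ⁆ , (⊤ - c) - d)

IndepΘ : (n : ℕ) → ESet n → Set
IndepΘ n I = ∃[ B ] (IsBasisΘ n B × (I ⊆E B))

HasRankΘ : (n : ℕ) → ESet n → ℕ → Set
HasRankΘ n A k =
  (∃[ I ] (IndepΘ n I × (I ⊆E A) × size I ≡ k)) ×
  (∀ I → IndepΘ n I → I ⊆E A → size I ≤ k)

IsFlatΘ : (n : ℕ) → ESet n → Set
IsFlatΘ n F = ∀ (e : Elt n) → ¬ (e ∈E F) →
  ∀ k k' → HasRankΘ n F k → HasRankΘ n (insert e F) k' → k < k'

Corank2Θ : (n : ℕ) → ESet n → Set
Corank2Θ n F = ∃[ r ] ∃[ k ] (HasRankΘ n groundE r × HasRankΘ n F k × k + 2 ≡ r)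

module Submission where

open import Defs
open import Data.Nat using (ℕ; suc; _≥_; _≤_; _<_; _+_; z≤n; s≤s)
open import Data.Nat.Properties
  using (≤-antisym; ≤-trans; ≤-reflexive; <-irrefl; ≤-pred; m≤n⇒m≤1+n; suc-injective; +-comm; +-mono-≤)
open import Data.Fin using (Fin; zero; suc)
open import Data.Fin.Properties using (_≟_; any?)
open import Data.Fin.Subset
  using (Subset; ⊥; ⊤; ⁅_⁆; _∪_; _─_; _-_; ∣_∣; _∈_; _∉_; _⊆_; Empty; inside; outside)
open import Data.Fin.Subset.Properties
open import Data.Vec using (_∷_; here; there)
open import Data.Sum using (_⊎_; inj₁; inj₂; [_,_]; map₂)
open import Data.Product using (_×_; _,_; ∃-syntax)
open import Relation.Binary.PropositionalEquality
  using (_≡_; _≢_; refl; sym; trans; cong; cong₂; subst; ≢-sym; module ≡-Reasoning)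
open import Relation.Nullary using (yes; no; ¬?; contradiction)
open import Relation.Nullary.Decidable using (_×-dec_)

-- Independent sets of Θₙ contain at most two elements of X, and adding to a subset B of Y
-- one element xₗ (resp. two) keeps it independent as soon as B misses some yₘ with m ≠ l
-- (resp. two elements of Y). So a set of rank n − 2 with X-part A misses exactly 2, 3 or
-- 4 elements of Y according as A is empty, a singleton, or larger. In the last case its
-- rank is already the maximum 2 + |B| for its Y-part B, so no xₗ can raise it and
-- flatness forces A = X.

x∈p─q⇒x∉q : ∀ {n} {p q : Subset n} {x : Fin n} → x ∈ p ─ q → x ∉ q
x∈p─q⇒x∉q {p = _ ∷ _} {outside ∷ _} here      ()
x∈p─q⇒x∉q {p = _ ∷ _} {_ ∷ _}       (there m) (there x∈q) = x∈p─q⇒x∉q m x∈q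

x∈p-y⇒x≢y : ∀ {n} {p : Subset n} {x y : Fin n} → x ∈ p - y → x ≢ y
x∈p-y⇒x≢y x∈p-y = x∉⁅y⁆⇒x≢y (x∈p─q⇒x∉q x∈p-y)

x∈p-y⇒x∈p : ∀ {n} {p : Subset n} {x y : Fin n} → x ∈ p - y → x ∈ p
x∈p-y⇒x∈p {p = p} {y = y} = p─q⊆p p ⁅ y ⁆

x∉p-x : ∀ {n} (p : Subset n) (x : Fin n) → x ∉ p - x
x∉p-x p x x∈p-x = x∈p-y⇒x≢y x∈p-x refl

x∈p⇒suc∣p-x∣≡∣p∣ : ∀ {n} {p : Subset n} {x : Fin n} → x ∈ p → suc ∣ p - x ∣ ≡ ∣ p ∣
x∈p⇒suc∣p-x∣≡∣p∣ {p = inside  ∷ p} here      = cong suc (cong ∣_∣ (p─⊥≡p p))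
x∈p⇒suc∣p-x∣≡∣p∣ {p = outside ∷ p} (there m) = x∈p⇒suc∣p-x∣≡∣p∣ m
x∈p⇒suc∣p-x∣≡∣p∣ {p = inside  ∷ p} (there m) = cong suc (x∈p⇒suc∣p-x∣≡∣p∣ m)

∣⁅x⁆∪⁅y⁆∣≡2 : ∀ {n} {x y : Fin n} → x ≢ y → ∣ ⁅ x ⁆ ∪ ⁅ y ⁆ ∣ ≡ 2
∣⁅x⁆∪⁅y⁆∣≡2 {x = zero}  {zero}  x≢y = contradiction refl x≢y
∣⁅x⁆∪⁅y⁆∣≡2 {x = zero}  {suc y} _ = cong suc (trans (cong ∣_∣ (∪-identityˡ ⁅ y ⁆)) (∣⁅x⁆∣≡1 y))
∣⁅x⁆∪⁅y⁆∣≡2 {x = suc x} {zero}  _ = cong suc (trans (cong ∣_∣ (∪-identityʳ ⁅ x ⁆)) (∣⁅x⁆∣≡1 x))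
∣⁅x⁆∪⁅y⁆∣≡2 {x = suc x} {suc y} x≢y = ∣⁅x⁆∪⁅y⁆∣≡2 (λ x≡y → x≢y (cong suc x≡y))

x∈p⇒⁅x⁆⊆p : ∀ {n} {p : Subset n} {x : Fin n} → x ∈ p → ⁅ x ⁆ ⊆ p
x∈p⇒⁅x⁆⊆p {x = x} x∈p y∈⁅x⁆ = subst (_∈ _) (sym (x∈⁅y⁆⇒x≡y x y∈⁅x⁆)) x∈p

x,y∈p⇒⁅x⁆∪⁅y⁆⊆p : ∀ {n} {p : Subset n} {x y : Fin n} → x ∈ p → y ∈ p → ⁅ x ⁆ ∪ ⁅ y ⁆ ⊆ p
x,y∈p⇒⁅x⁆∪⁅y⁆⊆p {x = x} {y} x∈p y∈p z∈ =
  [ x∈p⇒⁅x⁆⊆p x∈p , x∈p⇒⁅x⁆⊆p y∈p ] (x∈p∪q⁻ ⁅ x ⁆ ⁅ y ⁆ z∈)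

p⊆q∧x∉p⇒p⊆q-x : ∀ {n} {p q : Subset n} {x : Fin n} → p ⊆ q → x ∉ p → p ⊆ q - x
p⊆q∧x∉p⇒p⊆q-x p⊆q x∉p y∈p = x∈p∧x≢y⇒x∈p-y (p⊆q y∈p) (λ { refl → x∉p y∈p })

p⊆q∧∣p∣<∣q∣⇒p⊆q-x : ∀ {n} {p q : Subset n} → p ⊆ q → ∣ p ∣ < ∣ q ∣ →
                 ∃[ x ] (x ∈ q × p ⊆ q - x × suc ∣ q - x ∣ ≡ ∣ q ∣)
p⊆q∧∣p∣<∣q∣⇒p⊆q-x {p = p} {q} p⊆q ∣p∣<∣q∣ with any? (λ x → x ∈? q ×-dec ¬? (x ∈? p))
... | yes (x , x∈q , x∉p) = x , x∈q , p⊆q∧x∉p⇒p⊆q-x p⊆q x∉p , x∈p⇒suc∣p-x∣≡∣p∣ x∈q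
... | no none = contradiction (≤-trans ∣p∣<∣q∣ (p⊆q⇒∣p∣≤∣q∣ q⊆p)) (<-irrefl refl)
  where
  q⊆p : q ⊆ p
  q⊆p {x} x∈q with x ∈? p
  ... | yes x∈p = x∈p
  ... | no  x∉p = contradiction (x , x∈q , x∉p) none

p⊆q∧∣q∣≤∣p∣⇒p≡q : ∀ {n} {p q : Subset n} → p ⊆ q → ∣ q ∣ ≤ ∣ p ∣ → p ≡ q
p⊆q∧∣q∣≤∣p∣⇒p≡q {p = p} {q} p⊆q ∣q∣≤∣p∣ = ⊆-antisym p⊆q q⊆p
  where
  q⊆p : q ⊆ p
  q⊆p {x} x∈q with x ∈? p
  ... | yes x∈p = x∈p
  ... | no  x∉p = contradiction
    (≤-trans (x∈p⇒∣p-x∣<∣p∣ x∈q) (≤-trans ∣q∣≤∣p∣ (p⊆q⇒∣p∣≤∣q∣ (p⊆q∧x∉p⇒p⊆q-x p⊆q x∉p)))) (<-irrefl refl)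

empty⊎singleton⊎two : ∀ {n} (A : Subset n) →
  Empty A ⊎ (∃[ l ] A ≡ ⁅ l ⁆) ⊎ (∃[ l ] ∃[ l' ] (l ≢ l' × l ∈ A × l' ∈ A))
empty⊎singleton⊎two A with nonempty? A
... | no  A-empty = inj₁ A-empty
... | yes (l , l∈A) with any? (λ x → x ∈? A ×-dec ¬? (x ≟ l))
...   | yes (l' , l'∈A , l'≢l) = inj₂ (inj₂ (l , l' , ≢-sym l'≢l , l∈A , l'∈A))
...   | no  no-other = inj₂ (inj₁ (l , ⊆-antisym A⊆⁅l⁆ (x∈p⇒⁅x⁆⊆p l∈A)))
  where
  A⊆⁅l⁆ : A ⊆ ⁅ l ⁆
  A⊆⁅l⁆ {x} x∈A with x ≟ l
  ... | yes refl = x∈⁅x⁆ x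
  ... | no  x≢l  = contradiction (x , x∈A , x≢l) no-other

i≢j⇒i≢l⊎j≢l : ∀ {n} {i j : Fin n} → i ≢ j → (l : Fin n) → i ≢ l ⊎ j ≢ l
i≢j⇒i≢l⊎j≢l {i = i} i≢j l with i ≟ l
... | yes refl = inj₂ (≢-sym i≢j)
... | no  i≢l  = inj₁ i≢l

size-mono : ∀ {n} {I J : ESet n} → I ⊆E J → size I ≤ size J
size-mono (A⊆ , B⊆) = +-mono-≤ (p⊆q⇒∣p∣≤∣q∣ A⊆) (p⊆q⇒∣p∣≤∣q∣ B⊆)

⊆E-trans : ∀ {n} {I J K : ESet n} → I ⊆E J → J ⊆E K → I ⊆E K
⊆E-trans (A⊆ , B⊆) (A⊆' , B⊆') = ⊆-trans A⊆ A⊆' , ⊆-trans B⊆ B⊆'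

basis-size : ∀ {n} {B : ESet n} → IsBasisΘ n B → size B ≡ n
basis-size {n} basisY = trans (cong (_+ ∣ ⊤ {n} ∣) (∣⊥∣≡0 n)) (∣⊤∣≡n n)
basis-size {n} (basis1 i j _) = begin
  ∣ ⁅ j ⁆ ∣ + ∣ ⊤ {n} - i ∣  ≡⟨ cong (_+ ∣ ⊤ {n} - i ∣) (∣⁅x⁆∣≡1 j) ⟩
  suc ∣ ⊤ {n} - i ∣          ≡⟨ x∈p⇒suc∣p-x∣≡∣p∣ {n} ∈⊤ ⟩
  ∣ ⊤ {n} ∣                  ≡⟨ ∣⊤∣≡n n ⟩
  n                          ∎
  where open ≡-Reasoning
basis-size {n} (basis2 a b c d a≢b c≢d) = begin
  ∣ ⁅ a ⁆ ∪ ⁅ b ⁆ ∣ + ∣ ⊤ {n} - c - d ∣  ≡⟨ cong (_+ ∣ ⊤ {n} - c - d ∣) (∣⁅x⁆∪⁅y⁆∣≡2 a≢b) ⟩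
  suc (suc ∣ ⊤ {n} - c - d ∣)            ≡⟨ cong suc (x∈p⇒suc∣p-x∣≡∣p∣ (x∈p∧x≢y⇒x∈p-y ∈⊤ (≢-sym c≢d))) ⟩
  suc ∣ ⊤ {n} - c ∣                      ≡⟨ x∈p⇒suc∣p-x∣≡∣p∣ {n} ∈⊤ ⟩
  ∣ ⊤ {n} ∣                              ≡⟨ ∣⊤∣≡n n ⟩
  n                                      ∎
  where open ≡-Reasoning

basis-X≤2 : ∀ {n} {A B : Subset n} → IsBasisΘ n (A , B) → ∣ A ∣ ≤ 2
basis-X≤2 {n} basisY               = ≤-trans (≤-reflexive (∣⊥∣≡0 n)) z≤n
basis-X≤2 (basis1 _ j _)           = ≤-trans (≤-reflexive (∣⁅x⁆∣≡1 j)) (s≤s z≤n)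
basis-X≤2 (basis2 _ _ _ _ a≢b _)   = ≤-reflexive (∣⁅x⁆∪⁅y⁆∣≡2 a≢b)

indep-size≤n : ∀ {n} {I : ESet n} → IndepΘ n I → size I ≤ n
indep-size≤n (_ , basis , I⊆B) = ≤-trans (size-mono I⊆B) (≤-reflexive (basis-size basis))

indep⊆⇒size≤2+∣Y∣ : ∀ {n} {I : ESet n} {A B : Subset n} → IndepΘ n I → I ⊆E (A , B) → size I ≤ 2 + ∣ B ∣
indep⊆⇒size≤2+∣Y∣ ((A' , _) , basis , (I⊆A' , _)) (_ , I⊆B) =
  +-mono-≤ (≤-trans (p⊆q⇒∣p∣≤∣q∣ I⊆A') (basis-X≤2 basis)) (p⊆q⇒∣p∣≤∣q∣ I⊆B)

indep-Y : ∀ {n} (B : Subset n) → IndepΘ n (⊥ , B)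
indep-Y B = (⊥ , ⊤) , basisY , ⊆-refl , ⊆⊤

indep-x : ∀ {n} {B : Subset n} {l m : Fin n} → m ≢ l → m ∉ B → IndepΘ n (⁅ l ⁆ , B)
indep-x {l = l} {m} m≢l m∉B = (⁅ l ⁆ , ⊤ - m) , basis1 m l m≢l , ⊆-refl , p⊆q∧x∉p⇒p⊆q-x ⊆⊤ m∉B

indep-xx : ∀ {n} {B : Subset n} {a b c d : Fin n} → a ≢ b → c ≢ d → c ∉ B → d ∉ B →
           IndepΘ n (⁅ a ⁆ ∪ ⁅ b ⁆ , B)
indep-xx {a = a} {b} {c} {d} a≢b c≢d c∉B d∉B =
  (⁅ a ⁆ ∪ ⁅ b ⁆ , ⊤ - c - d) , basis2 a b c d a≢b c≢d ,
  ⊆-refl , p⊆q∧x∉p⇒p⊆q-x (p⊆q∧x∉p⇒p⊆q-x ⊆⊤ c∉B) d∉B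

rank≤size : ∀ {n k} {F : ESet n} → HasRankΘ n F k → k ≤ size F
rank≤size ((_ , _ , I⊆F , refl) , _) = size-mono I⊆F

rank≤2+∣Y∣ : ∀ {n k} {A B : Subset n} → HasRankΘ n (A , B) k → k ≤ 2 + ∣ B ∣
rank≤2+∣Y∣ ((_ , indep , I⊆F , refl) , _) = indep⊆⇒size≤2+∣Y∣ indep I⊆F

∣Y∣≤rank : ∀ {n k} {A B : Subset n} → HasRankΘ n (A , B) k → ∣ B ∣ ≤ k
∣Y∣≤rank {n} {k} {B = B} (_ , max) =
  subst (_≤ k) (cong (_+ ∣ B ∣) (∣⊥∣≡0 n)) (max (⊥ , B) (indep-Y B) (⊥⊆ , ⊆-refl))

1+∣Y∣≤rank : ∀ {n k} {A B : Subset n} {l m : Fin n} → HasRankΘ n (A , B) k →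
             l ∈ A → m ≢ l → m ∉ B → 1 + ∣ B ∣ ≤ k
1+∣Y∣≤rank {k = k} {B = B} {l} (_ , max) l∈A m≢l m∉B =
  subst (_≤ k) (cong (_+ ∣ B ∣) (∣⁅x⁆∣≡1 l)) (max _ (indep-x m≢l m∉B) (x∈p⇒⁅x⁆⊆p l∈A , ⊆-refl))

2+∣Y∣≤rank : ∀ {n k} {A B : Subset n} {a b c d : Fin n} → HasRankΘ n (A , B) k →
             a ≢ b → a ∈ A → b ∈ A → c ≢ d → c ∉ B → d ∉ B → 2 + ∣ B ∣ ≤ k
2+∣Y∣≤rank {k = k} {B = B} (_ , max) a≢b a∈A b∈A c≢d c∉B d∉B =
  subst (_≤ k) (cong (_+ ∣ B ∣) (∣⁅x⁆∪⁅y⁆∣≡2 a≢b))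
    (max _ (indep-xx a≢b c≢d c∉B d∉B) (x,y∈p⇒⁅x⁆∪⁅y⁆⊆p a∈A b∈A , ⊆-refl))

rank-ground : ∀ {n r} → HasRankΘ n groundE r → r ≡ n
rank-ground {r = r} ((_ , indep , _ , refl) , max) =
  ≤-antisym (indep-size≤n indep) (subst (_≤ r) (basis-size basisY) (max (⊥ , ⊤) (indep-Y ⊤) (⊥⊆ , ⊆-refl)))

corank2⇒rank : ∀ {n} {F : ESet n} → Corank2Θ n F → ∃[ k ] (HasRankΘ n F k × n ≡ 2 + k)
corank2⇒rank (_ , k , rank-E , rank-F , k+2≡r) =
  k , rank-F , trans (sym (rank-ground rank-E)) (trans (sym k+2≡r) (+-comm k 2))

rank-extend : ∀ {n k} {F G : ESet n} → HasRankΘ n F k → F ⊆E G →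
              (∀ I → IndepΘ n I → I ⊆E G → size I ≤ k) → HasRankΘ n G k
rank-extend ((I , indep , I⊆F , ∣I∣≡k) , _) F⊆G max = (I , indep , ⊆E-trans I⊆F F⊆G , ∣I∣≡k) , max

flat⇒X-full : ∀ {n k} {A B : Subset n} → IsFlatΘ n (A , B) → HasRankΘ n (A , B) k → 2 + ∣ B ∣ ≤ k → A ≡ ⊤
flat⇒X-full {n} {k} {A} {B} flat rank 2+∣B∣≤k = ⊆-antisym ⊆⊤ (λ {x} _ → x∈A x)
  where
  x∈A : ∀ x → x ∈ A
  x∈A x with x ∈? A
  ... | yes x∈A = x∈A
  ... | no  x∉A = contradiction (flat (inj₁ x) x∉A k k rank rank-with-x) (<-irrefl refl)
    where
    rank-with-x : HasRankΘ n (⁅ x ⁆ ∪ A , B) k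
    rank-with-x = rank-extend rank (q⊆p∪q ⁅ x ⁆ A , ⊆-refl)
      (λ I indep I⊆ → ≤-trans (indep⊆⇒size≤2+∣Y∣ indep I⊆) 2+∣B∣≤k)

Form₁ Form₂ Form₃ Form₄ : (n : ℕ) → ESet n → Set
Form₁ n F = ∃[ i ] ∃[ j ] ∃[ k ] ∃[ l ]
  (i ≢ j × i ≢ k × i ≢ l × j ≢ k × j ≢ l × k ≢ l × F ≡ (⊤ , ⊤ - i - j - k - l))
Form₂ n F = ∃[ i ] ∃[ j ] ∃[ k ] ∃[ l ]
  (i ≢ j × i ≢ k × i ≢ l × j ≢ k × j ≢ l × k ≢ l × F ≡ (⁅ l ⁆ , ⊤ - i - j - k))
Form₃ n F = ∃[ i ] ∃[ j ] ∃[ k ] (i ≢ j × i ≢ k × j ≢ k × F ≡ (⁅ i ⁆ , ⊤ - i - j - k))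
Form₄ n F = ∃[ i ] ∃[ j ] (i ≢ j × F ≡ (⊥ , ⊤ - i - j))

x∪Y-3-forms : ∀ {n} {i j k : Fin n} → i ≢ j → i ≢ k → j ≢ k → (l : Fin n) →
              Form₂ n (⁅ l ⁆ , ⊤ - i - j - k) ⊎ Form₃ n (⁅ l ⁆ , ⊤ - i - j - k)
x∪Y-3-forms {i = i} {j} {k} i≢j i≢k j≢k l with l ≟ i | l ≟ j | l ≟ k
... | yes refl | _        | _        = inj₂ (l , j , k , i≢j , i≢k , j≢k , refl)
... | no _     | yes refl | _        = inj₂ (l , i , k , ≢-sym i≢j , j≢k , i≢k ,
  cong (⁅ l ⁆ ,_) (cong (_- k) (p─x─y≡p─y─x ⊤ i l)))
... | no _     | no _     | yes refl = inj₂ (l , i , j , ≢-sym i≢k , ≢-sym j≢k , i≢j ,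
  cong (⁅ l ⁆ ,_) (trans (p─x─y≡p─y─x (⊤ - i) j l) (cong (_- j) (p─x─y≡p─y─x ⊤ i l))))
... | no l≢i   | no l≢j   | no l≢k   =
  inj₁ (i , j , k , l , i≢j , i≢k , ≢-sym l≢i , j≢k , ≢-sym l≢j , ≢-sym l≢k , refl)

module _ {n k : ℕ} (n≡2+k : n ≡ 2 + k) where

  Y-misses-two : ∀ {A B : Subset n} → HasRankΘ n (A , B) k →
                 ∃[ i ] ∃[ j ] (i ≢ j × B ⊆ ⊤ - i - j × ∣ ⊤ - i - j ∣ ≡ k)
  Y-misses-two {B = B} rank =
    let i , _ , B⊆⊤-i , 1+∣⊤-i∣≡∣⊤∣ = p⊆q∧∣p∣<∣q∣⇒p⊆q-x ⊆⊤ ∣B∣<∣⊤∣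
        ∣⊤-i∣≡1+k = suc-injective (trans 1+∣⊤-i∣≡∣⊤∣ ∣⊤∣≡2+k)
        j , j∈⊤-i , B⊆⊤-i-j , 1+∣⊤-i-j∣≡∣⊤-i∣ =
          p⊆q∧∣p∣<∣q∣⇒p⊆q-x B⊆⊤-i (subst (suc ∣ B ∣ ≤_) (sym ∣⊤-i∣≡1+k) (s≤s ∣B∣≤k))
    in i , j , ≢-sym (x∈p-y⇒x≢y j∈⊤-i) , B⊆⊤-i-j , suc-injective (trans 1+∣⊤-i-j∣≡∣⊤-i∣ ∣⊤-i∣≡1+k)
    where
    ∣B∣≤k : ∣ B ∣ ≤ k
    ∣B∣≤k = ∣Y∣≤rank rank
    ∣⊤∣≡2+k : ∣ ⊤ {n} ∣ ≡ 2 + k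
    ∣⊤∣≡2+k = trans (∣⊤∣≡n n) n≡2+k
    ∣B∣<∣⊤∣ : ∣ B ∣ < ∣ ⊤ {n} ∣
    ∣B∣<∣⊤∣ = subst (suc ∣ B ∣ ≤_) (sym ∣⊤∣≡2+k) (m≤n⇒m≤1+n (s≤s ∣B∣≤k))

  Y-misses-three : ∀ {A B : Subset n} {l : Fin n} → HasRankΘ n (A , B) k → l ∈ A →
                   ∃[ i ] ∃[ j ] ∃[ m ]
                     (i ≢ j × i ≢ m × j ≢ m × B ⊆ ⊤ - i - j - m × suc ∣ ⊤ - i - j - m ∣ ≡ k)
  Y-misses-three {B = B} {l} rank l∈A =
    let i , j , i≢j , B⊆⊤-i-j , ∣⊤-i-j∣≡k = Y-misses-two rank
        i∉B : i ∉ B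
        i∉B i∈B = x∉p-x ⊤ i (x∈p-y⇒x∈p (B⊆⊤-i-j i∈B))
        j∉B : j ∉ B
        j∉B j∈B = x∉p-x (⊤ - i) j (B⊆⊤-i-j j∈B)
        1+∣B∣≤k = [ (λ i≢l → 1+∣Y∣≤rank rank l∈A i≢l i∉B) , (λ j≢l → 1+∣Y∣≤rank rank l∈A j≢l j∉B) ]
                    (i≢j⇒i≢l⊎j≢l i≢j l)
        m , m∈⊤-i-j , B⊆⊤-i-j-m , 1+∣⊤-i-j-m∣≡∣⊤-i-j∣ =
          p⊆q∧∣p∣<∣q∣⇒p⊆q-x B⊆⊤-i-j (subst (suc ∣ B ∣ ≤_) (sym ∣⊤-i-j∣≡k) 1+∣B∣≤k)
    in i , j , m , i≢j , ≢-sym (x∈p-y⇒x≢y (x∈p-y⇒x∈p m∈⊤-i-j)) , ≢-sym (x∈p-y⇒x≢y m∈⊤-i-j) ,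
       B⊆⊤-i-j-m , trans 1+∣⊤-i-j-m∣≡∣⊤-i-j∣ ∣⊤-i-j∣≡k

  empty-X⇒Form₄ : ∀ {B : Subset n} → HasRankΘ n (⊥ , B) k → Form₄ n (⊥ , B)
  empty-X⇒Form₄ {B} rank =
    let i , j , i≢j , B⊆⊤-i-j , ∣⊤-i-j∣≡k = Y-misses-two rank
        k≤∣B∣ : k ≤ ∣ B ∣
        k≤∣B∣ = subst (λ a → k ≤ a + ∣ B ∣) (∣⊥∣≡0 n) (rank≤size rank)
    in i , j , i≢j , cong (⊥ ,_) (p⊆q∧∣q∣≤∣p∣⇒p≡q B⊆⊤-i-j (subst (_≤ ∣ B ∣) (sym ∣⊤-i-j∣≡k) k≤∣B∣))

  singleton-X⇒Form₂⊎Form₃ : ∀ {B : Subset n} {l : Fin n} → HasRankΘ n (⁅ l ⁆ , B) k →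
                            Form₂ n (⁅ l ⁆ , B) ⊎ Form₃ n (⁅ l ⁆ , B)
  singleton-X⇒Form₂⊎Form₃ {B} {l} rank =
    let i , j , m , i≢j , i≢m , j≢m , B⊆⊤-i-j-m , 1+∣⊤-i-j-m∣≡k = Y-misses-three rank (x∈⁅x⁆ l)
        k≤1+∣B∣ : k ≤ 1 + ∣ B ∣
        k≤1+∣B∣ = subst (λ a → k ≤ a + ∣ B ∣) (∣⁅x⁆∣≡1 l) (rank≤size rank)
        B≡⊤-i-j-m = p⊆q∧∣q∣≤∣p∣⇒p≡q B⊆⊤-i-j-m
          (≤-pred (subst (_≤ 1 + ∣ B ∣) (sym 1+∣⊤-i-j-m∣≡k) k≤1+∣B∣))
    in subst (λ Y → Form₂ n (⁅ l ⁆ , Y) ⊎ Form₃ n (⁅ l ⁆ , Y)) (sym B≡⊤-i-j-m) (x∪Y-3-forms i≢j i≢m j≢m l)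

  two-X⇒Form₁ : ∀ {A B : Subset n} {l l' : Fin n} → IsFlatΘ n (A , B) → HasRankΘ n (A , B) k →
                l ≢ l' → l ∈ A → l' ∈ A → Form₁ n (A , B)
  two-X⇒Form₁ {B = B} flat rank l≢l' l∈A l'∈A =
    let i , j , m , i≢j , i≢m , j≢m , B⊆⊤-i-j-m , 1+∣⊤-i-j-m∣≡k = Y-misses-three rank l∈A
        j∉B : j ∉ B
        j∉B j∈B = x∉p-x (⊤ - i) j (x∈p-y⇒x∈p (B⊆⊤-i-j-m j∈B))
        m∉B : m ∉ B
        m∉B m∈B = x∉p-x (⊤ - i - j) m (B⊆⊤-i-j-m m∈B)
        2+∣B∣≤k = 2+∣Y∣≤rank rank l≢l' l∈A l'∈A j≢m j∉B m∉B
        o , o∈⊤-i-j-m , B⊆⊤-i-j-m-o , 1+∣⊤-i-j-m-o∣≡∣⊤-i-j-m∣ =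
          p⊆q∧∣p∣<∣q∣⇒p⊆q-x B⊆⊤-i-j-m (≤-pred (subst (2 + ∣ B ∣ ≤_) (sym 1+∣⊤-i-j-m∣≡k) 2+∣B∣≤k))
        2+∣⊤-i-j-m-o∣≡k = trans (cong suc 1+∣⊤-i-j-m-o∣≡∣⊤-i-j-m∣) 1+∣⊤-i-j-m∣≡k
        B≡⊤-i-j-m-o = p⊆q∧∣q∣≤∣p∣⇒p≡q B⊆⊤-i-j-m-o
          (≤-pred (≤-pred (subst (_≤ 2 + ∣ B ∣) (sym 2+∣⊤-i-j-m-o∣≡k) (rank≤2+∣Y∣ rank))))
        o≢m = x∈p-y⇒x≢y o∈⊤-i-j-m
        o≢j = x∈p-y⇒x≢y (x∈p-y⇒x∈p o∈⊤-i-j-m)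
        o≢i = x∈p-y⇒x≢y (x∈p-y⇒x∈p (x∈p-y⇒x∈p o∈⊤-i-j-m))
    in i , j , m , o , i≢j , i≢m , ≢-sym o≢i , j≢m , ≢-sym o≢j , ≢-sym o≢m ,
       cong₂ _,_ (flat⇒X-full flat rank 2+∣B∣≤k) B≡⊤-i-j-m-o

proposition5p2 : (n : ℕ) → n ≥ 2 → (F : ESet n) →
    IsFlatΘ n F → Corank2Θ n F →
    (∃[ i ] ∃[ j ] ∃[ k ] ∃[ l ]
        (i ≢ j × i ≢ k × i ≢ l × j ≢ k × j ≢ l × k ≢ l ×
         F ≡ (⊤ , ⊤ - i - j - k - l)))
    ⊎ ((∃[ i ] ∃[ j ] ∃[ k ] ∃[ l ]
        (i ≢ j × i ≢ k × i ≢ l × j ≢ k × j ≢ l × k ≢ l ×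
         F ≡ (⁅ l ⁆ , ⊤ - i - j - k)))
    ⊎ ((∃[ i ] ∃[ j ] ∃[ k ]
        (i ≢ j × i ≢ k × j ≢ k ×
         F ≡ (⁅ i ⁆ , ⊤ - i - j - k)))
    ⊎ (∃[ i ] ∃[ j ]
        (i ≢ j × F ≡ (⊥ , ⊤ - i - j)))))
proposition5p2 n _ (A , B) flat corank2 with corank2⇒rank corank2 | empty⊎singleton⊎two A
... | k , rank , n≡2+k | inj₁ A-empty
  rewrite Empty-unique A-empty = inj₂ (inj₂ (inj₂ (empty-X⇒Form₄ n≡2+k rank)))
... | k , rank , n≡2+k | inj₂ (inj₁ (l , refl)) = inj₂ (map₂ inj₁ (singleton-X⇒Form₂⊎Form₃ n≡2+k rank))
... | k , rank , n≡2+k | inj₂ (inj₂ (l , l' , l≢l' , l∈A , l'∈A)) =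
  inj₁ (two-X⇒Form₁ n≡2+k flat rank l≢l' l∈A l'∈A)
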